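{- Let $n \geq 2$ and $m$ be integers with $0 \leq m < \binom{n}{2}$. Let $s,t$ be the (unique) natural numbers such that $\binom{n}{2}-m=\binom{s}{2}+t$ with $0<t\leq s$. Let $\alpha_u$ denote the maximum of the independence number $\alpha(G)$ over all simple graphs $G$ with $n$ vertices and $m$ edges. Then $$s=\begin{cases}\alpha_u-1 & \text{if } \binom{n}{2}-m=\binom{s}{2}+s,\\ \alpha_u & \text{otherwise.}\end{cases}$$
   Context: All graphs are finite and simple. A $G(n,m)$ graph is a graph with $n$ vertices and $m$ edges. The independence number $\alpha(G)$ is the maximum size of an independent set of $G$. $\alpha_u$ is the sharp upper bound for the independence number of $G(n,m)$ graphs, i.e. the largest independence number attained by a graph with $n$ vertices and $m$ edges. -}

module Defs where

open import Data.Nat using (ℕ; _<ᵇ_)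
open import Data.Bool using (Bool; true; false; _∧_; if_then_else_)
open import Data.Fin using (Fin; toℕ)
open import Data.Fin.Subset using (Subset; _∈_; ∣_∣)
open import Data.List using (List; map; allFin)
open import Data.Nat.ListAction using (sum)
open import Data.Product using (Σ; _×_; ∃-syntax)
open import Relation.Binary.PropositionalEquality using (_≡_)
open import Data.Nat using (_≤_)

record Graph (n : ℕ) : Set where
  field
    adj   : Fin n → Fin n → Bool
    sym   : ∀ i j → adj i j ≡ adj j i
    irrefl : ∀ i → adj i i ≡ false
open Graph public

edgeCount : ∀ {n} → Graph n → ℕ
edgeCount {n} G =
  sum (map (λ i → sum (map (λ j →
        if (toℕ i <ᵇ toℕ j) ∧ adj G i j then 1 else 0) (allFin n))) (allFin n))

Independent : ∀ {n} → Graph n → Subset n → Set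
Independent G S = ∀ i j → i ∈ S → j ∈ S → adj G i j ≡ false

IsIndependenceNumber : ∀ {n} → Graph n → ℕ → Set
IsIndependenceNumber {n} G a =
  (∃[ S ] (Independent G S × ∣ S ∣ ≡ a)) ×
  (∀ (S : Subset n) → Independent G S → ∣ S ∣ ≤ a)

IsAlphaU : ℕ → ℕ → ℕ → Set
IsAlphaU n m a =
  (∃[ G ] (edgeCount {n} G ≡ m × IsIndependenceNumber G a)) ×
  (∀ (G : Graph n) (b : ℕ) → edgeCount G ≡ m → IsIndependenceNumber G b → b ≤ a)

{-# OPTIONS --safe #-}
-- An independent set S of a graph with m edges spans ∣S∣ C 2 non-edges, so
-- ∣S∣ C 2 ≤ n C 2 ∸ m =: N. Conversely, take as non-edges the first N pairs in
-- colexicographic order. All pairs inside {0, …, k-1} precede every other pair,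
-- so {0, …, k-1} is independent as soon as k C 2 ≤ N. Hence α_u is the largest
-- k with k C 2 ≤ N; for N = s C 2 + t with 0 < t ≤ s this is s + 1 when t = s
-- (then N = (s+1) C 2) and s otherwise.
module Submission where

open import Data.Bool using (Bool; true; false; _∧_; not; if_then_else_)
open import Data.Bool.Properties using (∧-zeroʳ; ∧-identityʳ; T-≡)
open import Data.Fin using (Fin; toℕ; inject₁; fromℕ) renaming (zero to fzero; suc to fsuc)
open import Data.Fin.Properties using (toℕ-inject₁; toℕ-fromℕ; toℕ<n; toℕ≤pred[n])
open import Data.Fin.Subset using (Subset; _∈_; ∣_∣)
open import Data.List using (map; allFin)
import Data.List as List using (tabulate)
open import Data.List.Properties using (map-tabulate)
open import Data.Nat
  using (ℕ; zero; suc; _+_; _∸_; _≤_; _<_; _<ᵇ_; _⊓_; _⊔_; z≤n; s≤s; s≤s⁻¹; z<s; _<?_)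
open import Data.Nat.Combinatorics using (_C_; nCk+nC[k+1]≡[n+1]C[k+1]; nC1≡n)
open import Data.Nat.ListAction using () renaming (sum to listSum)
open import Data.Nat.Properties
open import Data.Product using (_×_; _,_)
open import Data.Sum using (inj₁; inj₂)
open import Data.Vec using (lookup; tabulate; _∷_; [])
open import Data.Vec.Properties using (lookup∘tabulate; []=⇒lookup; lookup⇒[]=)
open import Function using (_∘_; Equivalence)
open import Relation.Binary.PropositionalEquality
open import Relation.Nullary using (yes; no; contradiction)
open import Relation.Nullary.Reflects using (ofʸ; ofⁿ)

open import Defs hiding (sym)
open import Algebra.Properties.CommutativeMonoid.Sum +-0-commutativeMonoid
  using (sum; sum-syntax; ∑-distrib-+; sum-cong-≗; sum-init-last; sum-replicate-zero)

⟦_⟧ : Bool → ℕ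
⟦ b ⟧ = if b then 1 else 0

<⇒<ᵇ≡true : ∀ {x y} → x < y → (x <ᵇ y) ≡ true
<⇒<ᵇ≡true {zero}  (s≤s _)   = refl
<⇒<ᵇ≡true {suc x} (s≤s x<y) = <⇒<ᵇ≡true x<y

≥⇒<ᵇ≡false : ∀ {x y} → y ≤ x → (x <ᵇ y) ≡ false
≥⇒<ᵇ≡false z≤n       = refl
≥⇒<ᵇ≡false (s≤s y≤x) = ≥⇒<ᵇ≡false y≤x

m+n<ᵇo≡n<ᵇo∸m : ∀ m n o → (m + n <ᵇ o) ≡ (n <ᵇ o ∸ m)
m+n<ᵇo≡n<ᵇo∸m zero    n o       = refl
m+n<ᵇo≡n<ᵇo∸m (suc m) n zero    = refl
m+n<ᵇo≡n<ᵇo∸m (suc m) n (suc o) = m+n<ᵇo≡n<ᵇo∸m m n o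

m⊓n+[m∸n]⊓o≡m⊓[n+o] : ∀ m n o → m ⊓ n + (m ∸ n) ⊓ o ≡ m ⊓ (n + o)
m⊓n+[m∸n]⊓o≡m⊓[n+o] m n o with ≤-total m n
... | inj₁ m≤n = begin
  m ⊓ n + (m ∸ n) ⊓ o   ≡⟨ cong₂ (λ x y → x + y ⊓ o) (m≤n⇒m⊓n≡m m≤n) (m≤n⇒m∸n≡0 m≤n) ⟩
  m + 0                 ≡⟨ +-identityʳ m ⟩
  m                     ≡⟨ sym (m≤n⇒m⊓n≡m (≤-trans m≤n (m≤m+n n o))) ⟩
  m ⊓ (n + o)           ∎
  where open ≡-Reasoning
... | inj₂ n≤m = begin
  m ⊓ n + (m ∸ n) ⊓ o   ≡⟨ cong (_+ (m ∸ n) ⊓ o) (m≥n⇒m⊓n≡n n≤m) ⟩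
  n + (m ∸ n) ⊓ o       ≡⟨ +-distribˡ-⊓ n (m ∸ n) o ⟩
  (n + (m ∸ n)) ⊓ (n + o) ≡⟨ cong (_⊓ (n + o)) (m+[n∸m]≡n n≤m) ⟩
  m ⊓ (n + o)           ∎
  where open ≡-Reasoning

[1+n]C2≡nC2+n : ∀ n → suc n C 2 ≡ n C 2 + n
[1+n]C2≡nC2+n n = begin
  suc n C 2        ≡⟨ sym (nCk+nC[k+1]≡[n+1]C[k+1] n 1) ⟩
  n C 1 + n C 2    ≡⟨ cong (_+ n C 2) (nC1≡n n) ⟩
  n + n C 2        ≡⟨ +-comm n (n C 2) ⟩
  n C 2 + n        ∎
  where open ≡-Reasoning

C2-mono : ∀ {m n} → m ≤ n → m C 2 ≤ n C 2
C2-mono {n = n} z≤n = z≤n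
C2-mono {suc m} {suc n} (s≤s m≤n) = begin
  suc m C 2    ≡⟨ [1+n]C2≡nC2+n m ⟩
  m C 2 + m    ≤⟨ +-mono-≤ (C2-mono m≤n) m≤n ⟩
  n C 2 + n    ≡⟨ sym ([1+n]C2≡nC2+n n) ⟩
  suc n C 2    ∎
  where open ≤-Reasoning

C2-cancel-< : ∀ {m n} → m C 2 < n C 2 → m < n
C2-cancel-< {m} {n} mC2<nC2 with m <? n
... | yes m<n = m<n
... | no  m≮n = contradiction (C2-mono (≮⇒≥ m≮n)) (<⇒≱ mC2<nC2)

∑-mono-≤ : ∀ {n} {f g : Fin n → ℕ} → (∀ i → f i ≤ g i) → sum f ≤ sum g
∑-mono-≤ {zero}  f≤g = z≤n
∑-mono-≤ {suc n} f≤g = +-mono-≤ (f≤g fzero) (∑-mono-≤ (f≤g ∘ fsuc))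

count : ∀ {n} → (Fin n → Bool) → ℕ
count {n} p = ∑[ i < n ] ⟦ p i ⟧

count-false : ∀ n → count {n} (λ _ → false) ≡ 0
count-false n = sum-replicate-zero n

count-true : ∀ n → count {n} (λ _ → true) ≡ n
count-true zero    = refl
count-true (suc n) = cong suc (count-true n)

count-cong : ∀ {n} {p q : Fin n → Bool} → (∀ i → p i ≡ q i) → count p ≡ count q
count-cong p≗q = sum-cong-≗ (λ i → cong ⟦_⟧ (p≗q i))

count-init-last : ∀ {n} (p : Fin (suc n) → Bool) →
  count p ≡ count (λ i → p (inject₁ i)) + ⟦ p (fromℕ n) ⟧
count-init-last p = sum-init-last (λ i → ⟦ p i ⟧)

count-<ᵇ : ∀ n y → count {n} (λ i → toℕ i <ᵇ y) ≡ y ⊓ n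
count-<ᵇ zero    y       = sym (⊓-zeroʳ y)
count-<ᵇ (suc n) zero    = count-false n
count-<ᵇ (suc n) (suc y) = cong suc (count-<ᵇ n y)

count-lookup : ∀ {n} (S : Subset n) → count (lookup S) ≡ ∣ S ∣
count-lookup []          = refl
count-lookup (true ∷ S)  = cong suc (count-lookup S)
count-lookup (false ∷ S) = count-lookup S

_<ᶠ_ : ∀ {n} → Fin n → Fin n → Bool
i <ᶠ j = toℕ i <ᵇ toℕ j

countPairs : ∀ {n} → (Fin n → Fin n → Bool) → ℕ
countPairs {n} R = ∑[ i < n ] ∑[ j < n ] ⟦ i <ᶠ j ∧ R i j ⟧

countPairs-cong : ∀ {n} {R Q : Fin n → Fin n → Bool} →
  (∀ {i j} → toℕ i < toℕ j → R i j ≡ Q i j) → countPairs R ≡ countPairs Q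
countPairs-cong {R = R} {Q} R≐Q = sum-cong-≗ λ i → sum-cong-≗ λ j → ascending i j
  where
  ascending : ∀ i j → ⟦ i <ᶠ j ∧ R i j ⟧ ≡ ⟦ i <ᶠ j ∧ Q i j ⟧
  ascending i j with i <ᶠ j | <ᵇ-reflects-< (toℕ i) (toℕ j)
  ... | true  | ofʸ i<j = cong ⟦_⟧ (R≐Q i<j)
  ... | false | ofⁿ _   = refl

countPairs-init-last : ∀ {n} (R : Fin (suc n) → Fin (suc n) → Bool) →
  countPairs R ≡ countPairs (λ i j → R (inject₁ i) (inject₁ j))
                 + count (λ i → R (inject₁ i) (fromℕ n))
countPairs-init-last {n} R = begin
    countPairs R
  ≡⟨ sum-cong-≗ (λ i → sum-init-last (f i)) ⟩
    ∑[ i < suc n ] (∑[ j < n ] f i (inject₁ j) + f i (fromℕ n))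
  ≡⟨ ∑-distrib-+ (λ i → ∑[ j < n ] f i (inject₁ j)) (λ i → f i (fromℕ n)) ⟩
    ∑[ i < suc n ] ∑[ j < n ] f i (inject₁ j) + ∑[ i < suc n ] f i (fromℕ n)
  ≡⟨ cong₂ _+_ (sum-init-last (λ i → ∑[ j < n ] f i (inject₁ j)))
               (sum-init-last (λ i → f i (fromℕ n))) ⟩
    (∑[ i < n ] ∑[ j < n ] f (inject₁ i) (inject₁ j) + ∑[ j < n ] f (fromℕ n) (inject₁ j))
      + (∑[ i < n ] f (inject₁ i) (fromℕ n) + f (fromℕ n) (fromℕ n))
  ≡⟨ cong₂ _+_
       (cong₂ _+_ old-pairs
                  (trans (sum-cong-≗ (no-pair-from-last ∘ inject₁)) (sum-replicate-zero n)))
       (cong₂ _+_ (sum-cong-≗ pair-to-last) (no-pair-from-last (fromℕ n))) ⟩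
    (old + 0) + (new + 0)
  ≡⟨ cong₂ _+_ (+-identityʳ old) (+-identityʳ new) ⟩
    old + new
  ∎
  where
  open ≡-Reasoning
  f : Fin (suc n) → Fin (suc n) → ℕ
  f i j = ⟦ i <ᶠ j ∧ R i j ⟧
  old new : ℕ
  old = countPairs (λ i j → R (inject₁ i) (inject₁ j))
  new = count (λ i → R (inject₁ i) (fromℕ n))
  no-pair-from-last : ∀ j → f (fromℕ n) j ≡ 0
  no-pair-from-last j rewrite toℕ-fromℕ n | ≥⇒<ᵇ≡false (toℕ≤pred[n] j) = refl
  pair-to-last : ∀ i → f (inject₁ i) (fromℕ n) ≡ ⟦ R (inject₁ i) (fromℕ n) ⟧
  pair-to-last i rewrite toℕ-inject₁ i | toℕ-fromℕ n | <⇒<ᵇ≡true (toℕ<n i) = refl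
  old-pairs : ∑[ i < n ] ∑[ j < n ] f (inject₁ i) (inject₁ j) ≡ old
  old-pairs = sum-cong-≗ λ i → sum-cong-≗ λ j →
    cong (λ b → ⟦ b ∧ R (inject₁ i) (inject₁ j) ⟧)
         (cong₂ _<ᵇ_ (toℕ-inject₁ i) (toℕ-inject₁ j))

countPairs-all : ∀ n → countPairs {n} (λ _ _ → true) ≡ n C 2
countPairs-all zero    = refl
countPairs-all (suc n) = begin
    countPairs {suc n} (λ _ _ → true)
  ≡⟨ countPairs-init-last {n} (λ _ _ → true) ⟩
    countPairs {n} (λ _ _ → true) + count {n} (λ _ → true)
  ≡⟨ cong₂ _+_ (countPairs-all n) (count-true n) ⟩
    n C 2 + n
  ≡⟨ sym ([1+n]C2≡nC2+n n) ⟩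
    suc n C 2
  ∎
  where open ≡-Reasoning

countPairs-within : ∀ {n} (p : Fin n → Bool) →
  countPairs (λ i j → p i ∧ p j) ≡ count p C 2
countPairs-within {zero}  p = refl
countPairs-within {suc n} p = begin
    countPairs (λ i j → p i ∧ p j)
  ≡⟨ countPairs-init-last (λ i j → p i ∧ p j) ⟩
    countPairs (λ i j → p′ i ∧ p′ j) + count (λ i → p′ i ∧ p (fromℕ n))
  ≡⟨ cong (_+ count (λ i → p′ i ∧ p (fromℕ n))) (countPairs-within p′) ⟩
    count p′ C 2 + count (λ i → p′ i ∧ p (fromℕ n))
  ≡⟨ add-last (p (fromℕ n)) ⟩
    (count p′ + ⟦ p (fromℕ n) ⟧) C 2
  ≡⟨ cong (_C 2) (sym (count-init-last p)) ⟩
    count p C 2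
  ∎
  where
  open ≡-Reasoning
  p′ : Fin n → Bool
  p′ i = p (inject₁ i)
  add-last : ∀ b → count p′ C 2 + count (λ i → p′ i ∧ b) ≡ (count p′ + ⟦ b ⟧) C 2
  add-last true  = begin
    count p′ C 2 + count (λ i → p′ i ∧ true)
      ≡⟨ cong (count p′ C 2 +_) (count-cong (∧-identityʳ ∘ p′)) ⟩
    count p′ C 2 + count p′
      ≡⟨ sym ([1+n]C2≡nC2+n (count p′)) ⟩
    suc (count p′) C 2
      ≡⟨ cong (_C 2) (+-comm 1 (count p′)) ⟩
    (count p′ + 1) C 2 ∎
  add-last false = begin
    count p′ C 2 + count (λ i → p′ i ∧ false)
      ≡⟨ cong (count p′ C 2 +_) (trans (count-cong (∧-zeroʳ ∘ p′)) (count-false n)) ⟩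
    count p′ C 2 + 0
      ≡⟨ +-identityʳ (count p′ C 2) ⟩
    count p′ C 2
      ≡⟨ cong (_C 2) (sym (+-identityʳ (count p′))) ⟩
    (count p′ + 0) C 2 ∎

countPairs-+ : ∀ {n} (R Q : Fin n → Fin n → Bool) →
  countPairs R + countPairs Q ≡
  ∑[ i < n ] ∑[ j < n ] (⟦ i <ᶠ j ∧ R i j ⟧ + ⟦ i <ᶠ j ∧ Q i j ⟧)
countPairs-+ {n} R Q = begin
    countPairs R + countPairs Q
  ≡⟨ ∑-distrib-+ (λ i → ∑[ j < n ] r i j) (λ i → ∑[ j < n ] q i j) ⟨
    ∑[ i < n ] (∑[ j < n ] r i j + ∑[ j < n ] q i j)
  ≡⟨ sum-cong-≗ (λ i → ∑-distrib-+ (r i) (q i)) ⟨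
    ∑[ i < n ] ∑[ j < n ] (r i j + q i j)
  ∎
  where
  open ≡-Reasoning
  r q : Fin n → Fin n → ℕ
  r i j = ⟦ i <ᶠ j ∧ R i j ⟧
  q i j = ⟦ i <ᶠ j ∧ Q i j ⟧

countPairs-disjoint : ∀ {n} (R Q : Fin n → Fin n → Bool) →
  (∀ i j → R i j ∧ Q i j ≡ false) → countPairs R + countPairs Q ≤ n C 2
countPairs-disjoint {n} R Q disjoint = begin
  countPairs R + countPairs Q
    ≡⟨ countPairs-+ R Q ⟩
  ∑[ i < n ] ∑[ j < n ] (⟦ i <ᶠ j ∧ R i j ⟧ + ⟦ i <ᶠ j ∧ Q i j ⟧)
    ≤⟨ ∑-mono-≤ (λ i → ∑-mono-≤ (λ j →
         at-most-one (i <ᶠ j) (R i j) (Q i j) (disjoint i j))) ⟩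
  countPairs {n} (λ _ _ → true)
    ≡⟨ countPairs-all n ⟩
  n C 2 ∎
  where
  open ≤-Reasoning
  at-most-one : ∀ b r q → r ∧ q ≡ false → ⟦ b ∧ r ⟧ + ⟦ b ∧ q ⟧ ≤ ⟦ b ∧ true ⟧
  at-most-one false r     q     _  = z≤n
  at-most-one true  false false _  = z≤n
  at-most-one true  false true  _  = ≤-refl
  at-most-one true  true  false _  = ≤-refl

countPairs-complement : ∀ {n} (R : Fin n → Fin n → Bool) →
  countPairs (λ i j → not (R i j)) + countPairs R ≡ n C 2
countPairs-complement {n} R = begin
  countPairs (λ i j → not (R i j)) + countPairs R
    ≡⟨ countPairs-+ (λ i j → not (R i j)) R ⟩
  ∑[ i < n ] ∑[ j < n ] (⟦ i <ᶠ j ∧ not (R i j) ⟧ + ⟦ i <ᶠ j ∧ R i j ⟧)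
    ≡⟨ sum-cong-≗ (λ i → sum-cong-≗ (λ j → exactly-one (i <ᶠ j) (R i j))) ⟩
  countPairs {n} (λ _ _ → true)
    ≡⟨ countPairs-all n ⟩
  n C 2 ∎
  where
  open ≡-Reasoning
  exactly-one : ∀ b r → ⟦ b ∧ not r ⟧ + ⟦ b ∧ r ⟧ ≡ ⟦ b ∧ true ⟧
  exactly-one false r     = refl
  exactly-one true  false = refl
  exactly-one true  true  = refl

listSum-allFin : ∀ n (f : Fin n → ℕ) → listSum (map f (allFin n)) ≡ ∑[ i < n ] f i
listSum-allFin n f = trans (cong listSum (map-tabulate (λ i → i) f)) (listSum-tabulate n f)
  where
  listSum-tabulate : ∀ n (f : Fin n → ℕ) → listSum (List.tabulate f) ≡ ∑[ i < n ] f i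
  listSum-tabulate zero    f = refl
  listSum-tabulate (suc n) f = cong (f fzero +_) (listSum-tabulate n (f ∘ fsuc))

edgeCount≡countPairs : ∀ {n} (G : Graph n) → edgeCount G ≡ countPairs (adj G)
edgeCount≡countPairs {n} G = begin
  edgeCount G
    ≡⟨ listSum-allFin n (λ i → listSum (map (f i) (allFin n))) ⟩
  ∑[ i < n ] listSum (map (f i) (allFin n))
    ≡⟨ sum-cong-≗ (λ i → listSum-allFin n (f i)) ⟩
  countPairs (adj G) ∎
  where
  open ≡-Reasoning
  f : Fin n → Fin n → ℕ
  f i j = ⟦ i <ᶠ j ∧ adj G i j ⟧

independent-bound : ∀ {n} (G : Graph n) (S : Subset n) → Independent G S →
  ∣ S ∣ C 2 + edgeCount G ≤ n C 2
independent-bound {n} G S independent = begin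
    ∣ S ∣ C 2 + edgeCount G
  ≡⟨ cong₂ _+_ (sym (trans (countPairs-within (lookup S)) (cong (_C 2) (count-lookup S))))
               (edgeCount≡countPairs G) ⟩
    countPairs (λ i j → lookup S i ∧ lookup S j) + countPairs (adj G)
  ≤⟨ countPairs-disjoint _ (adj G) non-adjacent ⟩
    n C 2
  ∎
  where
  open ≤-Reasoning
  non-adjacent : ∀ i j → (lookup S i ∧ lookup S j) ∧ adj G i j ≡ false
  non-adjacent i j with lookup S i in i∈ | lookup S j in j∈
  ... | true  | true  = independent i j (lookup⇒[]= i S i∈) (lookup⇒[]= j S j∈)
  ... | true  | false = refl
  ... | false | _     = refl

independent-C2≤ : ∀ {n m} (G : Graph n) (S : Subset n) → edgeCount G ≡ m →
  Independent G S → ∣ S ∣ C 2 ≤ n C 2 ∸ m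
independent-C2≤ {n} {m} G S G-edges independent = begin
  ∣ S ∣ C 2            ≤⟨ m+n≤o⇒m≤o∸n (∣ S ∣ C 2) (independent-bound G S independent) ⟩
  n C 2 ∸ edgeCount G  ≡⟨ cong (n C 2 ∸_) G-edges ⟩
  n C 2 ∸ m            ∎
  where open ≤-Reasoning

-- Listing the pairs a < b colexicographically (by b, then by a), the pair
-- (a, b) sits at position b C 2 + a; the pairs of Fin n get positions 0, …, n C 2 ∸ 1.
colexRank : ℕ → ℕ → ℕ
colexRank a b = b C 2 + a

colexRank<[1+b]C2 : ∀ {a b} → a < b → colexRank a b < suc b C 2
colexRank<[1+b]C2 {a} {b} a<b = begin-strict
  b C 2 + a   <⟨ +-monoʳ-< (b C 2) a<b ⟩
  b C 2 + b   ≡⟨ sym ([1+n]C2≡nC2+n b) ⟩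
  suc b C 2   ∎
  where open ≤-Reasoning

countPairs-colexRank< : ∀ n N →
  countPairs {n} (λ i j → colexRank (toℕ i) (toℕ j) <ᵇ N) ≡ N ⊓ (n C 2)
countPairs-colexRank< zero    N = sym (⊓-zeroʳ N)
countPairs-colexRank< (suc n) N = begin
    countPairs R
  ≡⟨ countPairs-init-last R ⟩
    countPairs (λ i j → R (inject₁ i) (inject₁ j)) + count (λ i → R (inject₁ i) (fromℕ n))
  ≡⟨ cong₂ _+_
       (trans (countPairs-cong (λ {i} {j} _ → old-pair i j)) (countPairs-colexRank< n N))
       (trans (count-cong new-pair) (count-<ᵇ n (N ∸ n C 2))) ⟩
    N ⊓ (n C 2) + (N ∸ n C 2) ⊓ n
  ≡⟨ m⊓n+[m∸n]⊓o≡m⊓[n+o] N (n C 2) n ⟩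
    N ⊓ (n C 2 + n)
  ≡⟨ cong (N ⊓_) (sym ([1+n]C2≡nC2+n n)) ⟩
    N ⊓ (suc n C 2)
  ∎
  where
  open ≡-Reasoning
  R : Fin (suc n) → Fin (suc n) → Bool
  R i j = colexRank (toℕ i) (toℕ j) <ᵇ N
  old-pair : ∀ i j → R (inject₁ i) (inject₁ j) ≡ (colexRank (toℕ i) (toℕ j) <ᵇ N)
  old-pair i j rewrite toℕ-inject₁ i | toℕ-inject₁ j = refl
  new-pair : ∀ i → R (inject₁ i) (fromℕ n) ≡ (toℕ i <ᵇ N ∸ n C 2)
  new-pair i rewrite toℕ-inject₁ i | toℕ-fromℕ n = m+n<ᵇo≡n<ᵇo∸m (n C 2) (toℕ i) N

beyond : ℕ → ℕ → ℕ → Bool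
beyond N a b = (a <ᵇ b) ∧ not (colexRank a b <ᵇ N)

beyond≡false : ∀ {N k a b} → b < k → k C 2 ≤ N → beyond N a b ≡ false
beyond≡false {N} {k} {a} {b} b<k kC2≤N with a <ᵇ b | <ᵇ-reflects-< a b
... | false | _       = refl
... | true  | ofʸ a<b =
  cong not (<⇒<ᵇ≡true (<-≤-trans (colexRank<[1+b]C2 a<b) (≤-trans (C2-mono b<k) kC2≤N)))

colexGraph : (n N : ℕ) → Graph n
colexGraph n N = record
  { adj    = λ i j → beyond N (toℕ i ⊓ toℕ j) (toℕ i ⊔ toℕ j)
  ; sym    = λ i j → cong₂ (beyond N) (⊓-comm (toℕ i) (toℕ j)) (⊔-comm (toℕ i) (toℕ j))
  ; irrefl = λ i → trans (cong₂ (beyond N) (⊓-idem (toℕ i)) (⊔-idem (toℕ i)))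
                         (beyond-refl (toℕ i))
  }
  where
  beyond-refl : ∀ a → beyond N a a ≡ false
  beyond-refl a rewrite ≥⇒<ᵇ≡false (≤-refl {a}) = refl

colexGraph-adj : ∀ {n N} {i j : Fin n} → toℕ i < toℕ j →
  adj (colexGraph n N) i j ≡ not (colexRank (toℕ i) (toℕ j) <ᵇ N)
colexGraph-adj i<j
  rewrite m≤n⇒m⊓n≡m (<⇒≤ i<j) | m≤n⇒m⊔n≡n (<⇒≤ i<j) | <⇒<ᵇ≡true i<j = refl

colexGraph-edgeCount : ∀ {n N} → N ≤ n C 2 → edgeCount (colexGraph n N) + N ≡ n C 2
colexGraph-edgeCount {n} {N} N≤nC2 = begin
    edgeCount (colexGraph n N) + N
  ≡⟨ cong₂ _+_
       (trans (edgeCount≡countPairs (colexGraph n N)) (countPairs-cong (colexGraph-adj {n} {N})))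
       (sym (trans (countPairs-colexRank< n N) (m≤n⇒m⊓n≡m N≤nC2))) ⟩
    countPairs (λ i j → not (R i j)) + countPairs R
  ≡⟨ countPairs-complement R ⟩
    n C 2
  ∎
  where
  open ≡-Reasoning
  R : Fin n → Fin n → Bool
  R i j = colexRank (toℕ i) (toℕ j) <ᵇ N

colexGraph-edges : ∀ {n m} → m ≤ n C 2 → edgeCount (colexGraph n (n C 2 ∸ m)) ≡ m
colexGraph-edges {n} {m} m≤nC2 = begin
  e                    ≡⟨ sym (m+n∸n≡m e N) ⟩
  e + N ∸ N            ≡⟨ cong (_∸ N) (colexGraph-edgeCount {n} (m∸n≤m (n C 2) m)) ⟩
  n C 2 ∸ (n C 2 ∸ m)  ≡⟨ m∸[m∸n]≡n m≤nC2 ⟩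
  m                    ∎
  where
  open ≡-Reasoning
  N e : ℕ
  N = n C 2 ∸ m
  e = edgeCount (colexGraph n N)

firstVertices : (n k : ℕ) → Subset n
firstVertices n k = tabulate (λ i → toℕ i <ᵇ k)

firstVertices-size : ∀ {n k} → k ≤ n → ∣ firstVertices n k ∣ ≡ k
firstVertices-size {n} {k} k≤n = begin
  ∣ firstVertices n k ∣
    ≡⟨ count-lookup (firstVertices n k) ⟨
  count (lookup (firstVertices n k))
    ≡⟨ count-cong {n} (lookup∘tabulate (λ i → toℕ i <ᵇ k)) ⟩
  count {n} (λ i → toℕ i <ᵇ k)
    ≡⟨ count-<ᵇ n k ⟩
  k ⊓ n
    ≡⟨ m≤n⇒m⊓n≡m k≤n ⟩
  k ∎
  where open ≡-Reasoning

∈firstVertices⇒< : ∀ {n k} {i : Fin n} → i ∈ firstVertices n k → toℕ i < k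
∈firstVertices⇒< {k = k} {i} i∈ = <ᵇ⇒< (toℕ i) k (Equivalence.from T-≡
  (trans (sym (lookup∘tabulate (λ i → toℕ i <ᵇ k) i)) ([]=⇒lookup i∈)))

firstVertices-independent : ∀ {n N k} → k C 2 ≤ N →
  Independent (colexGraph n N) (firstVertices n k)
firstVertices-independent {k = k} kC2≤N i j i∈ j∈ =
  beyond≡false {k = k} (⊔-pres-<m (∈firstVertices⇒< i∈) (∈firstVertices⇒< j∈)) kC2≤N

IsGreatest : (ℕ → Set) → ℕ → Set
IsGreatest P k = P k × (∀ x → P x → x ≤ k)

greatest-C2≤ : ∀ {N k} → k C 2 ≤ N → N < suc k C 2 → IsGreatest (λ x → x C 2 ≤ N) k
greatest-C2≤ kC2≤N N<[1+k]C2 =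
  kC2≤N , λ x xC2≤N → s≤s⁻¹ (C2-cancel-< (≤-<-trans xC2≤N N<[1+k]C2))

greatest-C2≤[s]C2+s : ∀ {s t} → t ≡ s → IsGreatest (λ x → x C 2 ≤ s C 2 + t) (suc s)
greatest-C2≤[s]C2+s {s} refl = greatest-C2≤ (≤-reflexive ([1+n]C2≡nC2+n s)) (begin-strict
  s C 2 + s               ≡⟨ sym ([1+n]C2≡nC2+n s) ⟩
  suc s C 2               <⟨ m<m+n (suc s C 2) z<s ⟩
  suc s C 2 + suc s       ≡⟨ sym ([1+n]C2≡nC2+n (suc s)) ⟩
  suc (suc s) C 2         ∎)
  where open ≤-Reasoning

greatest-C2≤[s]C2+t : ∀ {s t} → t < s → IsGreatest (λ x → x C 2 ≤ s C 2 + t) s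
greatest-C2≤[s]C2+t {s} {t} t<s = greatest-C2≤ (m≤m+n (s C 2) t) (begin-strict
  s C 2 + t   <⟨ +-monoʳ-< (s C 2) t<s ⟩
  s C 2 + s   ≡⟨ sym ([1+n]C2≡nC2+n s) ⟩
  suc s C 2   ∎)
  where open ≤-Reasoning

alphaU≡greatest : ∀ {n m k a} → m ≤ n C 2 → k ≤ n →
  IsGreatest (λ x → x C 2 ≤ n C 2 ∸ m) k → IsAlphaU n m a → k ≡ a
alphaU≡greatest {n} {m} {k} {a} m≤nC2 k≤n (kC2≤N , greatest)
  ((G , G-edges , (S , S-independent , ∣S∣≡a) , _) , maximal) = ≤-antisym k≤a a≤k
  where
  independent-≤k : ∀ (H : Graph n) → edgeCount H ≡ m → ∀ S → Independent H S → ∣ S ∣ ≤ k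
  independent-≤k H H-edges S independent =
    greatest ∣ S ∣ (independent-C2≤ H S H-edges independent)
  a≤k : a ≤ k
  a≤k = subst (_≤ k) ∣S∣≡a (independent-≤k G G-edges S S-independent)
  colex : Graph n
  colex = colexGraph n (n C 2 ∸ m)
  k≤a : k ≤ a
  k≤a = maximal colex k (colexGraph-edges {n} m≤nC2)
    ( (firstVertices n k , firstVertices-independent {k = k} kC2≤N , firstVertices-size k≤n)
    , independent-≤k colex (colexGraph-edges {n} m≤nC2) )

theorem3 : (n m s t a : ℕ) → 2 ≤ n → m < n C 2 →
    (n C 2) ∸ m ≡ (s C 2) + t → 0 < t → t ≤ s →
    IsAlphaU n m a →
    (t ≡ s → suc s ≡ a) × (t ≢ s → s ≡ a)
theorem3 n m s t a _ m<nC2 N≡ 0<t t≤s αu = t≡s⇒ , t≢s⇒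
  where
  s<n : s < n
  s<n = C2-cancel-< (begin-strict
    s C 2       <⟨ m<m+n (s C 2) 0<t ⟩
    s C 2 + t   ≡⟨ N≡ ⟨
    n C 2 ∸ m   ≤⟨ m∸n≤m (n C 2) m ⟩
    n C 2       ∎)
    where open ≤-Reasoning
  alphaU : ∀ {k} → k ≤ n → IsGreatest (λ x → x C 2 ≤ s C 2 + t) k → k ≡ a
  alphaU {k} k≤n greatest = alphaU≡greatest (<⇒≤ m<nC2) k≤n
    (subst (λ N → IsGreatest (λ x → x C 2 ≤ N) k) (sym N≡) greatest) αu
  t≡s⇒ : t ≡ s → suc s ≡ a
  t≡s⇒ t≡s = alphaU s<n (greatest-C2≤[s]C2+s t≡s)
  t≢s⇒ : t ≢ s → s ≡ a
  t≢s⇒ t≢s = alphaU (<⇒≤ s<n) (greatest-C2≤[s]C2+t (≤∧≢⇒< t≤s t≢s))
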